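{- Let $T$ be a sparse tournament of order $n>4$ and let $\sigma$ be a sparse ordering of $V(T)$. Then for any vertex $v$ with $d^-(v)=i$, the position of $v$ in $\sigma$ belongs to $\{i,i+1,i+2\}\cap\{1,\dots,n\}$.
   Context: A tournament is a digraph with exactly one arc between each pair of distinct vertices; $d^-(v)$ is the in-degree of $v$. Given an ordering $\sigma = \langle v_1,\dots,v_n\rangle$ of $V(T)$ (position of $v_j$ is $j$), an arc $(v_i,v_j)$ is backward if $j<i$. An ordering is sparse if every vertex is incident to at most one backward arc (i.e. the backward arcs form a matching). A tournament is sparse if it admits a sparse ordering. -}

module Defs where

open import Data.Nat using (ℕ; suc; _<_; _≤_; _+_)
open import Data.Bool using (Bool; true; false)
open import Data.Fin using (Fin; toℕ)
open import Data.Fin.Permutation using (Permutation′; _⟨$⟩ʳ_)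
open import Data.List using (List; filter; length)
open import Data.List using () renaming (allFin to allFinL)
open import Data.Product using (_×_; _,_; Σ)
open import Data.Sum using (_⊎_)
open import Relation.Binary.PropositionalEquality using (_≡_; _≢_)
open import Relation.Nullary using (¬_)
open import Data.Bool.Properties using () renaming (_≟_ to _≟B_)

-- A digraph on vertex set Fin n, given by its adjacency: A u v ≡ true iff (u,v) is an arc.
Digraph : ℕ → Set
Digraph n = Fin n → Fin n → Bool

record IsTournament {n : ℕ} (A : Digraph n) : Set where
  field
    irrefl    : ∀ u → A u u ≡ false
    total     : ∀ u v → u ≢ v → (A u v ≡ true) ⊎ (A v u ≡ true)
    antisym   : ∀ u v → A u v ≡ true → A v u ≡ false

inDegree : ∀ {n} → Digraph n → Fin n → ℕ
inDegree {n} A v = length (filter (λ u → A u v ≟B true) (allFinL n))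

-- An ordering of V(T) = Fin n: a permutation; ord ⟨$⟩ʳ v is the 0-based index of v.
Ordering : ℕ → Set
Ordering n = Permutation′ n

-- 1-based position of v in the ordering (as in the paper: v_j has position j).
pos : ∀ {n} → Ordering n → Fin n → ℕ
pos σ v = suc (toℕ (σ ⟨$⟩ʳ v))

Backward : ∀ {n} → Digraph n → Ordering n → Fin n → Fin n → Set
Backward A σ u w = (A u w ≡ true) × (pos σ w < pos σ u)

Incident : ∀ {n} → Fin n → Fin n → Fin n → Set
Incident v u w = (v ≡ u) ⊎ (v ≡ w)

IsSparseOrdering : ∀ {n} → Digraph n → Ordering n → Set
IsSparseOrdering A σ =
  ∀ v u w u′ w′ →
    Backward A σ u w → Incident v u w →
    Backward A σ u′ w′ → Incident v u′ w′ →
    (u ≡ u′) × (w ≡ w′)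

IsSparseTournament : ∀ {n} → Digraph n → Set
IsSparseTournament {n} A = IsTournament A × Σ (Ordering n) (IsSparseOrdering A)

-- Split the vertices u ≠ v by the direction of the arc between u and v and by
-- whether u comes before v. An in-neighbour after v and an out-neighbour before v
-- each give a backward arc at v, and by sparsity there is at most one such arc.
-- Hence d⁻(v) ≤ p + 1 and p ≤ d⁻(v) + 1, where p = pos v − 1 counts the
-- predecessors of v.
module Submission where

open import Defs
open import Data.Bool using (Bool; true; false; T; _∧_; _∨_)
open import Data.Bool.Properties using (T-≡; T-∧; T-∨) renaming (_≟_ to _≟B_)
open import Data.Empty using (⊥-elim)
open import Data.Fin using (Fin; zero; suc; toℕ)
open import Data.Fin.Permutation using (Permutation′; _⟨$⟩ʳ_)
open import Data.Fin.Properties as Fin using (toℕ-injective; toℕ<n)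
open import Data.List using (filter; length; tabulate)
open import Data.Nat using (ℕ; zero; suc; _<_; _≤_; _+_; _<ᵇ_; z≤n; s≤s)
open import Data.Nat.Properties
  using (suc-injective; ≤-refl; ≤-trans; ≤-reflexive; <⇒≤; <-irrefl; <-cmp; <ᵇ⇒<; <⇒<ᵇ;
         +-comm; +-suc; +-mono-≤; +-0-commutativeMonoid; module ≤-Reasoning)
open import Algebra.Properties.CommutativeMonoid.Sum +-0-commutativeMonoid
  using (sum; ∑-distrib-+; sum-permute)
open import Data.Product using (_×_; _,_; proj₁; proj₂)
open import Data.Sum using (_⊎_; inj₁; inj₂)
open import Function using (_∘_; Injection)
open import Function.Bundles using (Equivalence)
open import Function.Properties.Inverse using (↔⇒↣)
open import Relation.Binary using (tri<; tri≈; tri>)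
open import Relation.Binary.PropositionalEquality using (_≡_; refl; sym; cong; subst; module ≡-Reasoning)
open import Relation.Nullary using (¬_)

open Equivalence using (to; from)

𝟙 : Bool → ℕ
𝟙 true  = 1
𝟙 false = 0

count : ∀ {n} → (Fin n → Bool) → ℕ
count p = sum (𝟙 ∘ p)

sum-mono-≤ : ∀ {n} {f g : Fin n → ℕ} → (∀ i → f i ≤ g i) → sum f ≤ sum g
sum-mono-≤ {zero}  f≤g = z≤n
sum-mono-≤ {suc n} f≤g = +-mono-≤ (f≤g zero) (sum-mono-≤ (f≤g ∘ suc))

𝟙-mono : ∀ {x y} → (T x → T y) → 𝟙 x ≤ 𝟙 y
𝟙-mono {false}          _   = z≤n
𝟙-mono {true}  {true}   _   = ≤-refl
𝟙-mono {true}  {false} x⇒y = ⊥-elim (x⇒y _)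

𝟙-∨ : ∀ x y → 𝟙 (x ∨ y) ≤ 𝟙 x + 𝟙 y
𝟙-∨ true  _ = s≤s z≤n
𝟙-∨ false _ = ≤-refl

count-mono : ∀ {n} {p q : Fin n → Bool} → (∀ u → T (p u) → T (q u)) → count p ≤ count q
count-mono p⇒q = sum-mono-≤ (λ u → 𝟙-mono (p⇒q u))

count-∨ : ∀ {n} (p q : Fin n → Bool) → count (λ u → p u ∨ q u) ≤ count p + count q
count-∨ p q = ≤-trans (sum-mono-≤ (λ u → 𝟙-∨ (p u) (q u)))
                      (≤-reflexive (∑-distrib-+ (𝟙 ∘ p) (𝟙 ∘ q)))

count-covered : ∀ {n} {p q r : Fin n → Bool} →
  (∀ u → T (p u) → T (q u) ⊎ T (r u)) → count p ≤ count q + count r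
count-covered {q = q} {r} p⇒q∨r =
  ≤-trans (count-mono (λ u → from T-∨ ∘ p⇒q∨r u)) (count-∨ q r)

count-≡0 : ∀ {n} {p : Fin n → Bool} → (∀ u → p u ≡ false) → count p ≡ 0
count-≡0 {zero}          _      = refl
count-≡0 {suc n} {p} none rewrite none zero = count-≡0 (none ∘ suc)

count-≤1 : ∀ {n} (p : Fin n → Bool) →
  (∀ u u′ → T (p u) → T (p u′) → u ≡ u′) → count p ≤ 1
count-≤1 {zero}  _ _ = z≤n
count-≤1 {suc n} p unique with p zero in p₀
... | false = count-≤1 (p ∘ suc) (λ u u′ pu pu′ → Fin.suc-injective (unique (suc u) (suc u′) pu pu′))
... | true  = ≤-reflexive (cong suc (count-≡0 rest-false))
  where
  rest-false : ∀ u → p (suc u) ≡ false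
  rest-false u with p (suc u) in pᵤ
  ... | false = refl
  ... | true  with unique zero (suc u) (subst T (sym p₀) _) (subst T (sym pᵤ) _)
  ...   | ()

count-permute : ∀ {n} (p : Fin n → Bool) (π : Permutation′ n) → count (p ∘ (π ⟨$⟩ʳ_)) ≡ count p
count-permute p π = sym (sum-permute (𝟙 ∘ p) π)

count-toℕ<ᵇ : ∀ n k → k ≤ n → count {n} (λ j → toℕ j <ᵇ k) ≡ k
count-toℕ<ᵇ zero    zero    _         = refl
count-toℕ<ᵇ (suc n) zero    _         = count-≡0 {suc n} (λ _ → refl)
count-toℕ<ᵇ (suc n) (suc k) (s≤s k≤n) = cong suc (count-toℕ<ᵇ n k k≤n)

length-filter-tabulate : ∀ {A : Set} {n} (p : A → Bool) (f : Fin n → A) →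
  length (filter (λ x → p x ≟B true) (tabulate f)) ≡ count (p ∘ f)
length-filter-tabulate {n = zero}  p f = refl
length-filter-tabulate {n = suc n} p f with p (f zero)
... | true  = cong suc (length-filter-tabulate p (f ∘ suc))
... | false = length-filter-tabulate p (f ∘ suc)

inDegree≡count : ∀ {n} (A : Digraph n) (v : Fin n) → inDegree A v ≡ count (λ u → A u v)
inDegree≡count A v = length-filter-tabulate (λ u → A u v) (λ u → u)

module _ {n : ℕ} (σ : Ordering n) where

  pos-injective : ∀ {u w} → pos σ u ≡ pos σ w → u ≡ w
  pos-injective = Injection.injective (↔⇒↣ σ) ∘ toℕ-injective ∘ suc-injective

  precedes : Fin n → Fin n → Bool
  precedes u w = pos σ u <ᵇ pos σ w

  count-precedes : ∀ v → suc (count (λ u → precedes u v)) ≡ pos σ v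
  count-precedes v = cong suc (begin
    count (λ u → precedes u v)                ≡⟨ count-permute (λ j → toℕ j <ᵇ index) σ ⟩
    count {n} (λ j → toℕ j <ᵇ index)          ≡⟨ count-toℕ<ᵇ n index (<⇒≤ (toℕ<n (σ ⟨$⟩ʳ v))) ⟩
    index                                     ∎)
    where
    open ≡-Reasoning
    index = toℕ (σ ⟨$⟩ʳ v)

module _ {n : ℕ} (σ : Ordering n) (A : Digraph n) where

  Backward-irreflexive : ∀ {u} → ¬ Backward A σ u u
  Backward-irreflexive (_ , pos<pos) = <-irrefl refl pos<pos

  isBackward : Fin n → Fin n → Bool
  isBackward u w = A u w ∧ precedes σ w u

  isBackward-sound : ∀ {u w} → T (isBackward u w) → Backward A σ u w
  isBackward-sound {u} {w} t with to T-∧ t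
  ... | arc , w<u = to T-≡ arc , <ᵇ⇒< (pos σ w) (pos σ u) w<u

  isBackward-complete : ∀ {u w} → A u w ≡ true → pos σ w < pos σ u → T (isBackward u w)
  isBackward-complete arc w<u = from T-∧ (from T-≡ arc , <⇒<ᵇ w<u)

  backwardAt : Fin n → Fin n → Bool
  backwardAt v u = isBackward u v ∨ isBackward v u

  backwardAt-sound : ∀ {v u} → T (backwardAt v u) → Backward A σ u v ⊎ Backward A σ v u
  backwardAt-sound b with to T-∨ b
  ... | inj₁ uv = inj₁ (isBackward-sound uv)
  ... | inj₂ vu = inj₂ (isBackward-sound vu)

  count-backwardAt≤1 : IsSparseOrdering A σ → ∀ v → count (backwardAt v) ≤ 1
  count-backwardAt≤1 sparse v = count-≤1 (backwardAt v) unique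
    where
    unique : ∀ u u′ → T (backwardAt v u) → T (backwardAt v u′) → u ≡ u′
    unique u u′ b b′ with backwardAt-sound b | backwardAt-sound b′
    ... | inj₁ uv | inj₁ u′v = proj₁ (sparse v u v u′ v uv (inj₂ refl) u′v (inj₂ refl))
    ... | inj₂ vu | inj₂ vu′ = proj₂ (sparse v v u v u′ vu (inj₁ refl) vu′ (inj₁ refl))
    ... | inj₁ uv | inj₂ vu′ with sparse v u v v u′ uv (inj₂ refl) vu′ (inj₁ refl)
    ...   | refl , _ = ⊥-elim (Backward-irreflexive uv)
    unique u u′ b b′ | inj₂ vu | inj₁ u′v with sparse v v u u′ v vu (inj₁ refl) u′v (inj₂ refl)
    ...   | _ , refl = ⊥-elim (Backward-irreflexive vu)

  module _ (tournament : IsTournament A) (v : Fin n) where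
    open IsTournament tournament

    inNeighbour-covered : ∀ u → T (A u v) → T (precedes σ u v) ⊎ T (backwardAt v u)
    inNeighbour-covered u uv with <-cmp (pos σ u) (pos σ v)
    ... | tri< u<v _ _ = inj₁ (<⇒<ᵇ u<v)
    ... | tri> _ _ v<u = inj₂ (from T-∨ (inj₁ (isBackward-complete (to T-≡ uv) v<u)))
    ... | tri≈ _ u≡v _ with pos-injective σ u≡v
    ...   | refl = ⊥-elim (subst T (irrefl u) uv)

    predecessor-covered : ∀ u → T (precedes σ u v) → T (A u v) ⊎ T (backwardAt v u)
    predecessor-covered u u<ᵇv = cover (<ᵇ⇒< (pos σ u) (pos σ v) u<ᵇv)
      where
      cover : pos σ u < pos σ v → T (A u v) ⊎ T (backwardAt v u)
      cover u<v with total u v (λ { refl → <-irrefl refl u<v })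
      ... | inj₁ uv = inj₁ (from T-≡ uv)
      ... | inj₂ vu = inj₂ (from T-∨ (inj₂ (isBackward-complete vu u<v)))

mainTheorem5 : (n : ℕ) → 4 < n → (A : Digraph n) → IsSparseTournament A →
    (σ : Ordering n) → IsSparseOrdering A σ →
    (v : Fin n) → (i : ℕ) → inDegree A v ≡ i →
    (i ≤ pos σ v) × (pos σ v ≤ i + 2)
mainTheorem5 n _ A (tournament , _) σ sparse v i refl = lower , upper
  where
  open ≤-Reasoning
  inNeighbours predecessors backwardArcs : ℕ
  inNeighbours = count (λ u → A u v)
  predecessors = count (λ u → precedes σ u v)
  backwardArcs = count (backwardAt σ A v)

  lower : inDegree A v ≤ pos σ v
  lower = begin
    inDegree A v                 ≡⟨ inDegree≡count A v ⟩
    inNeighbours                 ≤⟨ count-covered (inNeighbour-covered σ A tournament v) ⟩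
    predecessors + backwardArcs  ≤⟨ +-mono-≤ ≤-refl (count-backwardAt≤1 σ A sparse v) ⟩
    predecessors + 1             ≡⟨ +-comm predecessors 1 ⟩
    suc predecessors             ≡⟨ count-precedes σ v ⟩
    pos σ v                      ∎

  upper : pos σ v ≤ inDegree A v + 2
  upper = begin
    pos σ v                            ≡⟨ count-precedes σ v ⟨
    suc predecessors                   ≤⟨ s≤s (count-covered (predecessor-covered σ A tournament v)) ⟩
    suc (inNeighbours + backwardArcs)  ≤⟨ s≤s (+-mono-≤ ≤-refl (count-backwardAt≤1 σ A sparse v)) ⟩
    suc (inNeighbours + 1)             ≡⟨ +-suc inNeighbours 1 ⟨
    inNeighbours + 2                   ≡⟨ cong (_+ 2) (inDegree≡count A v) ⟨
    inDegree A v + 2                   ∎
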